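{- Let $n\ge 2$ and let $F$ be the $n$-cell null-boundary non-uniform cellular automaton with rule vector $\langle \mathcal{R}_0,\dots,\mathcal{R}_{n-1}\rangle$. Let $S=(s_0,\dots,s_{n-1})$ and $D=(d_0,\dots,d_{n-1})$ be configurations in $\{0,1\}^n$, and let $\sigma_{n-1}=E_{n-1.a}$ and $\delta_{n-1}=E_{n-1.b}$ be the level-$(n-1)$ edges of the reachability tree whose indices $a$ and $b$ have binary representations $s_0s_1\cdots s_{n-1}$ and $d_0d_1\cdots d_{n-1}$ respectively. Then $D$ is reachable from $S$ if and only if there exists a path from $\delta_{n-1}$ to $\sigma_{n-1}$.
   Context: A rule is a map $\{0,1\}^3\to\{0,1\}$. A triple $(a,b,c)\in\{0,1\}^3$ is called a rule min term (RMT) and is identified with the integer $4a+2b+c\in\{0,\dots,7\}$; $\mathcal{R}[r]$ denotes the value of rule $\mathcal{R}$ on RMT $r$. The $n$-cell null-boundary non-uniform CA with rule vector $\langle \mathcal{R}_0,\dots,\mathcal{R}_{n-1}\rangle$ is the map $F:\{0,1\}^n\to\{0,1\}^n$, $F(x)_i=\mathcal{R}_i[4x_{i-1}+2x_i+x_{i+1}]$ for $0\le i\le n-1$, with the convention $x_{ -1}=x_n=0$. A configuration $D$ is reachable from $S$ if $D=F^t(S)$ for some integer $t\ge 1$. Reachability tree edges, labels and links: for $0\le i\le n-1$ the edges of level $i$ are $E_{i.j}$, $0\le j\le 2^{i+1}-1$, where $E_{i.j}$ is identified with the bit string $b_0b_1\cdots b_i$ that is the $(i+1)$-bit binary representation of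 $j$ ($b_0$ most significant). Call a tuple $(x_0,\dots,x_{i+1})\in\{0,1\}^{i+2}$ (with $x_{i+1}=0$ required when $i=n-1$, and $x_{ -1}:=0$) a witness for $E_{i.j}$ if $\mathcal{R}_m[4x_{m-1}+2x_m+x_{m+1}]=b_m$ for all $0\le m\le i$; its RMT is $r=4x_{i-1}+2x_i+x_{i+1}$. The label $l_{i.j}$ is the set of RMTs of witnesses for $E_{i.j}$. For each witness of $E_{i.j}$ with RMT $r$, there is a link from $E_{i.j}$ to $E_{i.k}$ for RMT $r$, written $E_{i.j}(r)\to E_{i.k}$, where $k$ is the integer with binary representation $x_0x_1\cdots x_i$. A path from $E_{i.j}$ to $E_{i.k}$ is a finite sequence of one or more links $E_{i.j}=E_{i.j_1}(r_1)\to E_{i.j_2}(r_2)\to\cdots\to E_{i.j_m}=E_{i.k}$. -}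

module Defs where

open import Data.Bool using (Bool; true; false)
open import Data.Nat using (ℕ; zero; suc; _<_; _≤_; s≤s; z≤n)
open import Data.Nat.Properties using (<-≤-trans; m≤n⇒m≤1+n)
open import Data.Fin using (Fin; toℕ; fromℕ<)
open import Data.Fin.Properties using (toℕ<n)
open import Data.Vec using (Vec; []; _∷_; lookup; tabulate; init)
open import Data.Product using (Σ; _×_; ∃-syntax)
open import Relation.Binary.PropositionalEquality using (_≡_)
open import Function using (_∘_)

-- A rule is a map {0,1}^3 → {0,1}; we present it as its table indexed by the
-- RMT number 4a+2b+c ∈ {0,…,7}, i.e. R[r] = R r.
Rule : Set
Rule = Fin 8 → Bool

rmt : Bool → Bool → Bool → Fin 8
rmt a b c = fromℕ< {4 * b2n a + 2 * b2n b + b2n c} (bound a b c)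
  where
  open import Data.Nat using (_*_; _+_)
  b2n : Bool → ℕ
  b2n false = 0
  b2n true  = 1
  bound : (a b c : Bool) → 4 * b2n a + 2 * b2n b + b2n c < 8
  bound false false false = s≤s z≤n
  bound false false true  = s≤s (s≤s z≤n)
  bound false true  false = s≤s (s≤s (s≤s z≤n))
  bound false true  true  = s≤s (s≤s (s≤s (s≤s z≤n)))
  bound true  false false = s≤s (s≤s (s≤s (s≤s (s≤s z≤n))))
  bound true  false true  = s≤s (s≤s (s≤s (s≤s (s≤s (s≤s z≤n)))))
  bound true  true  false = s≤s (s≤s (s≤s (s≤s (s≤s (s≤s (s≤s z≤n))))))
  bound true  true  true  = s≤s (s≤s (s≤s (s≤s (s≤s (s≤s (s≤s (s≤s z≤n)))))))

-- cell x_m of a bit string, with value 0 outside the string (null boundary)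
get : ∀ {k} → Vec Bool k → ℕ → Bool
get []       _       = false
get (b ∷ _)  zero    = b
get (_ ∷ bs) (suc m) = get bs m

getL : ∀ {k} → Vec Bool k → ℕ → Bool
getL x zero    = false
getL x (suc m) = get x m

Config : ℕ → Set
Config n = Vec Bool n

F : ∀ {n} → Vec Rule n → Config n → Config n
F {n} R x = tabulate λ i →
  lookup R i (rmt (getL x (toℕ i)) (get x (toℕ i)) (get x (suc (toℕ i))))

iterate : ∀ {A : Set} → (A → A) → ℕ → A → A
iterate f zero    a = a
iterate f (suc t) a = f (iterate f t a)

Reachable : ∀ {n} → Vec Rule n → Config n → Config n → Set
Reachable R S D = Σ ℕ λ t → (1 ≤ t) × (iterate (F R) t S ≡ D)

ruleAt : ∀ {n} → Vec Rule n → (m : ℕ) → m < n → Rule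
ruleAt R m m<n = lookup R (fromℕ< m<n)

-- Edges of level i (i < n) of the reachability tree: E_{i.j} identified with
-- the (i+1)-bit string b_0 … b_i (binary representation of j, b_0 MSB).
Edge : ℕ → Set
Edge i = Vec Bool (suc i)

record Witness {n : ℕ} (R : Vec Rule n) (i : ℕ) (i<n : i < n) (e : Edge i) : Set where
  field
    x        : Vec Bool (suc (suc i))
    boundary : suc i ≡ n → get x (suc i) ≡ false
    rules    : (m : Fin (suc i)) →
               ruleAt R (toℕ m) (<-≤-trans (toℕ<n m) i<n)
                 (rmt (getL x (toℕ m)) (get x (toℕ m)) (get x (suc (toℕ m))))
               ≡ lookup e m
  rmtOf : Fin 8
  rmtOf = rmt (getL x i) (get x i) (get x (suc i))
  -- target edge E_{i.k}, k having binary representation x_0 … x_i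
  target : Edge i
  target = init x

Link : ∀ {n} → Vec Rule n → (i : ℕ) → i < n → Edge i → Fin 8 → Edge i → Set
Link R i i<n e r e' =
  Σ (Witness R i i<n e) λ w → (Witness.rmtOf w ≡ r) × (Witness.target w ≡ e')

data Path {n : ℕ} (R : Vec Rule n) (i : ℕ) (i<n : i < n) : Edge i → Edge i → Set where
  one  : ∀ {e e' r} → Link R i i<n e r e' → Path R i i<n e e'
  more : ∀ {e e' e'' r} → Link R i i<n e r e' → Path R i i<n e' e'' → Path R i i<n e e''

module Submission where

open import Defs
open import Data.Nat using (ℕ; zero; suc; _<_; s≤s; z≤n)
open import Data.Nat.Properties using (n<1+n; <-≤-trans)
open import Data.Vec using (Vec; []; _∷_; _∷ʳ_; init; initLast; lookup; tabulate)
open import Data.Vec.Properties using (init-∷ʳ; lookup∘tabulate; tabulate∘lookup; tabulate-cong)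
open import Data.Fin using (Fin; toℕ)
open import Data.Fin.Properties using (fromℕ<-toℕ; toℕ<n)
open import Data.Bool using (Bool; false)
open import Data.Product using (Σ; _,_)
open import Relation.Binary.PropositionalEquality
open import Function using (_$_)
open import Function.Bundles using (_⇔_; mk⇔)
open ≡-Reasoning

-- At the last level a witness is a string x₀ … x_{n-1} padded by the boundary
-- cell x_n = 0, so its rule constraints say exactly F(x₀ … x_{n-1}) = e.
-- Hence a link e(r) → e' at level n-1 is the same as F e' ≡ e, and a path of
-- t links from D to S is a run F^t S ≡ D read backwards.

rmtAt : ∀ {k} → Vec Bool k → ℕ → Fin 8
rmtAt x j = rmt (getL x j) (get x j) (get x (suc j))

get-length : ∀ {k} (v : Vec Bool k) → get v k ≡ false
get-length []      = refl
get-length (_ ∷ v) = get-length v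

get-∷ʳ-false : ∀ {k} (v : Vec Bool k) → get (v ∷ʳ false) ≗ get v
get-∷ʳ-false []      zero    = refl
get-∷ʳ-false []      (suc j) = refl
get-∷ʳ-false (_ ∷ v) zero    = refl
get-∷ʳ-false (_ ∷ v) (suc j) = get-∷ʳ-false v j

rmtAt-∷ʳ-false : ∀ {k} (v : Vec Bool k) j →
                 rmtAt (v ∷ʳ false) j ≡ rmtAt v j
rmtAt-∷ʳ-false v zero
  rewrite get-∷ʳ-false v 0 | get-∷ʳ-false v 1 = refl
rmtAt-∷ʳ-false v (suc j)
  rewrite get-∷ʳ-false v j | get-∷ʳ-false v (suc j) | get-∷ʳ-false v (suc (suc j)) = refl

init-∷ʳ-false : ∀ {k} (x : Vec Bool (suc k)) → get x k ≡ false → init x ∷ʳ false ≡ x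
init-∷ʳ-false x last≡false with initLast x
... | v , y , refl = cong (v ∷ʳ_) (trans (sym last≡false) (get-length-∷ʳ v y))
  where
  get-length-∷ʳ : ∀ {l} (u : Vec Bool l) (z : Bool) → get (u ∷ʳ z) l ≡ z
  get-length-∷ʳ []      z = refl
  get-length-∷ʳ (_ ∷ u) z = get-length-∷ʳ u z

rmtAt-init : ∀ {k} (x : Vec Bool (suc k)) → get x k ≡ false →
             ∀ j → rmtAt (init x) j ≡ rmtAt x j
rmtAt-init x last≡false j = begin
  rmtAt (init x) j            ≡⟨ rmtAt-∷ʳ-false (init x) j ⟨
  rmtAt (init x ∷ʳ false) j   ≡⟨ cong (λ y → rmtAt y j) (init-∷ʳ-false x last≡false) ⟩
  rmtAt x j                   ∎

ruleAt-toℕ : ∀ {n} (R : Vec Rule n) (i : Fin n) p → ruleAt R (toℕ i) p ≡ lookup R i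
ruleAt-toℕ R i p = cong (lookup R) (fromℕ<-toℕ i p)

module LastLevel {k : ℕ} (R : Vec Rule (suc k)) where

  LastPath : Config (suc k) → Config (suc k) → Set
  LastPath = Path R k (n<1+n k)

  cell<n : (i : Fin (suc k)) → toℕ i < suc k
  cell<n i = <-≤-trans (toℕ<n i) (n<1+n k)

  F-target : ∀ {e} (w : Witness R k (n<1+n k) e) → F R (Witness.target w) ≡ e
  F-target {e} w = begin
    F R (init x)          ≡⟨ tabulate-cong cell ⟩
    tabulate (lookup e)   ≡⟨ tabulate∘lookup e ⟩
    e                     ∎
    where
    open Witness w
    cell : ∀ i → lookup R i (rmtAt (init x) (toℕ i)) ≡ lookup e i
    cell i = begin
      lookup R i (rmtAt (init x) (toℕ i))            ≡⟨ cong (lookup R i) (rmtAt-init x (boundary refl) (toℕ i)) ⟩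
      lookup R i (rmtAt x (toℕ i))                   ≡⟨ cong (_$ _) (ruleAt-toℕ R i (cell<n i)) ⟨
      ruleAt R (toℕ i) (cell<n i) (rmtAt x (toℕ i))  ≡⟨ rules i ⟩
      lookup e i                                     ∎

  paddedWitness : (x : Config (suc k)) → Witness R k (n<1+n k) (F R x)
  paddedWitness x = record
    { x        = x ∷ʳ false
    ; boundary = λ _ → trans (get-∷ʳ-false x (suc k)) (get-length x)
    ; rules    = λ i → begin
        ruleAt R (toℕ i) (cell<n i) (rmtAt (x ∷ʳ false) (toℕ i))
          ≡⟨ cong₂ _$_ (ruleAt-toℕ R i (cell<n i)) (rmtAt-∷ʳ-false x (toℕ i)) ⟩
        lookup R i (rmtAt x (toℕ i))
          ≡⟨ lookup∘tabulate (λ j → lookup R j (rmtAt x (toℕ j))) i ⟨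
        lookup (F R x) i
          ∎
    }

  link⇒F : ∀ {e r e'} → Link R k (n<1+n k) e r e' → F R e' ≡ e
  link⇒F (w , _ , refl) = F-target w

  F⇒link : ∀ x → Link R k (n<1+n k) (F R x) (Witness.rmtOf (paddedWitness x)) x
  F⇒link x = paddedWitness x , refl , init-∷ʳ false x

  iterate⇒path : ∀ t S → LastPath (iterate (F R) (suc t) S) S
  iterate⇒path zero    S = one (F⇒link S)
  iterate⇒path (suc t) S = more (F⇒link (iterate (F R) (suc t) S)) (iterate⇒path t S)

  path⇒iterate : ∀ {D S} → LastPath D S → Σ ℕ λ t → iterate (F R) (suc t) S ≡ D
  path⇒iterate (one l)    = zero , link⇒F l
  path⇒iterate (more l p) with path⇒iterate p
  ... | t , refl = suc t , link⇒F l

theorem1 : (m : ℕ) (R : Vec Rule (suc (suc m))) (S D : Config (suc (suc m))) →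
    Reachable R S D ⇔ Path R (suc m) (n<1+n (suc m)) D S
theorem1 m R S D = mk⇔ reachable⇒path path⇒reachable
  where
  open LastLevel R
  reachable⇒path : Reachable R S D → LastPath D S
  reachable⇒path (suc t , _ , refl) = iterate⇒path t S
  path⇒reachable : LastPath D S → Reachable R S D
  path⇒reachable p with path⇒iterate p
  ... | t , F^t+1S≡D = suc t , s≤s z≤n , F^t+1S≡D
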